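{- Let $r$ be an odd positive integer and let $n = 2p_1^{\alpha_1}p_2^{\alpha_2}\cdots p_s^{\alpha_s}$, where $s$ is a positive integer, $p_1<p_2<\cdots<p_s$ are odd primes, and $\alpha_1,\ldots,\alpha_s$ are positive integers. Then $n$ is a Schemmel nontotient number of order $r$ if and only if $n+r$ is composite and $p_s - r \neq 2p_1^{\alpha_1}p_2^{\alpha_2}\cdots p_{s-1}^{\alpha_{s-1}}$ (the product being empty, hence $p_s - r \ne 2$, when $s=1$).
   Context: For a positive integer $r$, the Schemmel totient function $S_r$ is the multiplicative arithmetic function determined by $S_r(p^{\alpha}) = 0$ if $p \le r$ and $S_r(p^{\alpha}) = p^{\alpha-1}(p-r)$ if $p > r$, for all primes $p$ and positive integers $\alpha$ (and $S_r(1)=1$). A Schemmel nontotient number of order $r$ is a positive integer not in the range of $S_r$. -}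

module Defs where

open import Data.Bool using (true; false)
open import Data.Nat using (ℕ; zero; suc; _+_; _*_; _∸_; _^_; _≤_; _<_; _<ᵇ_)
open import Data.Nat.Properties using (≤-trans; n≤1+n)
open import Data.Nat.Divisibility using (_∣_)
open import Data.Nat.Primality using (Prime)
open import Data.Fin using (Fin; fromℕ<)
open import Data.Product using (∃; ∃-syntax; _×_)
open import Relation.Nullary using (¬_)

-- Value of the Schemmel totient S_r on a prime power p^α (α ≥ 1):
-- 0 if p ≤ r, and p^(α-1) * (p - r) if p > r.
Sᵖᵖ : ℕ → ℕ → ℕ → ℕ
Sᵖᵖ r p α with r <ᵇ p
... | true  = p ^ (α ∸ 1) * (p ∸ r)
... | false = 0

-- The graph of the Schemmel totient function S_r: 'SchemmelGraph r n v'
-- means S_r(n) = v.  S_r is the multiplicative function with S_r(1) = 1 and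
-- the prescribed values on prime powers, so its graph is generated by
-- S_r(1) = 1 and S_r(p^α m) = S_r(p^α) S_r(m) for a prime p ∤ m, α ≥ 1.
data SchemmelGraph (r : ℕ) : ℕ → ℕ → Set where
  one  : SchemmelGraph r 1 1
  step : ∀ {m v} (p α : ℕ) → Prime p → 1 ≤ α → ¬ (p ∣ m) →
         SchemmelGraph r m v →
         SchemmelGraph r (p ^ α * m) (Sᵖᵖ r p α * v)

SchemmelNontotient : ℕ → ℕ → Set
SchemmelNontotient r n = 0 < n × ¬ (∃[ m ] SchemmelGraph r m n)

prodPow : ∀ {s} → (Fin s → ℕ) → (Fin s → ℕ) → (k : ℕ) → k ≤ s → ℕ
prodPow p α zero    _   = 1
prodPow p α (suc k) k<s =
  prodPow p α k (≤-trans (n≤1+n k) k<s) * (p (fromℕ< k<s) ^ α (fromℕ< k<s))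

-- For odd r every prime-power value S_r(p^α) is 0, 1 or even: p − r is even for odd p,
-- and p = 2 forces r = 1, where S_1(2^α) = 2^(α−1).  So if S_r(m) = 2P with P odd,
-- exactly one prime power of m contributes, and 2P = q^k (q − r) with q > r prime.
-- For k = 0 this says that q = 2P + r is prime.  For k ≥ 1 the prime q divides 2P,
-- so q ≤ p_s, while p_s divides q^k (q − r) and q − r < q ≤ p_s, so q = p_s; cancelling
-- the powers of p_s then leaves p_s − r = 2 p_1^α_1 ⋯ p_(s−1)^α_(s−1).  Conversely, in
-- each of these two situations the prime power q^(k+1) is a preimage of 2P.
module Submission where

open import Defs
open import Data.Nat using (ℕ; zero; suc; _+_; _*_; _∸_; _≤_; _<_; _^_; _<ᵇ_; s≤s; z≤n;
  NonZero; NonTrivial; >-nonZero; n>1⇒nonTrivial)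
open import Data.Nat.Properties
open import Data.Nat.Divisibility
open import Data.Nat.Primality using (Prime; Composite; euclidsLemma; prime[2]; ¬prime[1];
  prime⇒irreducible; prime⇒nonZero; ¬prime⇒composite; composite⇒¬prime)
open import Data.Fin using (Fin; fromℕ; fromℕ<; toℕ) renaming (_<_ to _<ᶠ_)
open import Data.Fin.Properties using (toℕ-fromℕ; toℕ-fromℕ<; fromℕ-def; ≤fromℕ)
  renaming (_≟_ to _≟ᶠ_; ≤∧≢⇒< to ≤∧≢⇒<ᶠ)
open import Data.Product using (_×_; _,_; ∃; ∃₂)
open import Data.Sum using (_⊎_; inj₁; inj₂)
open import Data.Bool using (true; false; T)
open import Data.Unit using (tt)
open import Data.Empty using (⊥-elim)
open import Function using (_∘_)
open import Function.Bundles using (_⇔_; mk⇔)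
open import Relation.Nullary using (¬_; yes; no)
open import Relation.Binary.PropositionalEquality

prime∤1 : ∀ {q} → Prime q → ¬ (q ∣ 1)
prime∤1 pq q∣1 with ∣1⇒≡1 q∣1
... | refl = ¬prime[1] pq

prime∣prime⇒≡ : ∀ {q p} → Prime q → Prime p → q ∣ p → q ≡ p
prime∣prime⇒≡ pq pp q∣p with prime⇒irreducible pp q∣p
... | inj₁ refl = ⊥-elim (¬prime[1] pq)
... | inj₂ q≡p  = q≡p

prime∣^⇒∣ : ∀ {q} m n → Prime q → q ∣ m ^ n → q ∣ m
prime∣^⇒∣ m zero    pq q∣1 = ⊥-elim (prime∤1 pq q∣1)
prime∣^⇒∣ m (suc n) pq q∣m^[1+n] with euclidsLemma m (m ^ n) pq q∣m^[1+n]
... | inj₁ q∣m   = q∣m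
... | inj₂ q∣m^n = prime∣^⇒∣ m n pq q∣m^n

m∣m^n : ∀ m {n} → 1 ≤ n → m ∣ m ^ n
m∣m^n m {suc n} _ = m∣m*n (m ^ n)

∣n∸m⇒<n : ∀ {d m n} → 0 < m → m < n → d ∣ n ∸ m → d < n
∣n∸m⇒<n {d} {m} {n} 0<m m<n d∣n∸m =
  ≤-<-trans (∣⇒≤ {{>-nonZero (m<n⇒0<n∸m m<n)}} d∣n∸m) (∸-monoʳ-< {n} {m} {0} 0<m (<⇒≤ m<n))

0<m<n⇒n∤n∸m : ∀ {m n} → 0 < m → m < n → ¬ (n ∣ n ∸ m)
0<m<n⇒n∤n∸m 0<m m<n = <-irrefl refl ∘ ∣n∸m⇒<n 0<m m<n

^-*-cancel-∤ : ∀ q b c {x y} → .{{NonZero q}} → ¬ (q ∣ x) → ¬ (q ∣ y) →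
               q ^ b * x ≡ q ^ c * y → x ≡ y
^-*-cancel-∤ q zero    zero    _ _ eq = *-cancelˡ-≡ _ _ 1 eq
^-*-cancel-∤ q zero    (suc c) {x} {y} q∤x _ eq =
  ⊥-elim (q∤x (subst (q ∣_) (trans (sym eq) (*-identityˡ x)) (∣m⇒∣m*n y (m∣m*n (q ^ c)))))
^-*-cancel-∤ q (suc b) zero    {x} {y} _ q∤y eq =
  ⊥-elim (q∤y (subst (q ∣_) (trans eq (*-identityˡ y)) (∣m⇒∣m*n x (m∣m*n (q ^ b)))))
^-*-cancel-∤ q (suc b) (suc c) {x} {y} q∤x q∤y eq =
  ^-*-cancel-∤ q b c q∤x q∤y
    (*-cancelˡ-≡ _ _ q (trans (sym (*-assoc q (q ^ b) x)) (trans eq (*-assoc q (q ^ c) y))))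

odd⇒≡1+x*2 : ∀ n → ¬ (2 ∣ n) → ∃ λ x → n ≡ suc (x * 2)
odd⇒≡1+x*2 zero          n-odd   = ⊥-elim (n-odd (2 ∣0))
odd⇒≡1+x*2 (suc zero)    _       = 0 , refl
odd⇒≡1+x*2 (suc (suc n)) 2+n-odd with odd⇒≡1+x*2 n (2+n-odd ∘ ∣m∣n⇒∣m+n (∣-refl {2}))
... | x , refl = suc x , refl

odd⇒0< : ∀ {n} → ¬ (2 ∣ n) → 0 < n
odd⇒0< {n} n-odd with odd⇒≡1+x*2 n n-odd
... | _ , refl = s≤s z≤n

odd∸odd-even : ∀ {m n} → ¬ (2 ∣ m) → ¬ (2 ∣ n) → 2 ∣ m ∸ n
odd∸odd-even {m} {n} m-odd n-odd with odd⇒≡1+x*2 m m-odd | odd⇒≡1+x*2 n n-odd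
... | x , refl | y , refl = divides (x ∸ y) (sym (*-distribʳ-∸ 2 x y))

2*n+1-odd : ∀ n → ¬ (2 ∣ 2 * n + 1)
2*n+1-odd n 2∣2n+1 = prime∤1 prime[2] (∣m+n∣m⇒∣n 2∣2n+1 (m∣m*n n))

2*odd≢0 : ∀ {n} → ¬ (2 ∣ n) → 2 * n ≢ 0
2*odd≢0 {n} n-odd 2n≡0 = n-odd (subst (2 ∣_) (sym (*-cancelˡ-≡ n 0 2 2n≡0)) (2 ∣0))

cofactor-odd : ∀ {m n k} → 2 ∣ m → m * n ≡ 2 * k → ¬ (2 ∣ k) → ¬ (2 ∣ n)
cofactor-odd 2∣m mn≡2k k-odd 2∣n =
  k-odd (*-cancelˡ-∣ 2 (subst (2 * 2 ∣_) mn≡2k (*-pres-∣ 2∣m 2∣n)))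

Sᵖᵖ-> : ∀ {r p} α → r < p → Sᵖᵖ r p α ≡ p ^ (α ∸ 1) * (p ∸ r)
Sᵖᵖ-> {r} {p} α r<p with r <ᵇ p | <⇒<ᵇ r<p
... | true | _ = refl

Sᵖᵖ≢0⇒> : ∀ {r p} α → Sᵖᵖ r p α ≢ 0 → r < p
Sᵖᵖ≢0⇒> {r} {p} α S≢0 with r <ᵇ p in r<ᵇp
... | true  = <ᵇ⇒< r p (subst T (sym r<ᵇp) tt)
... | false = ⊥-elim (S≢0 refl)

Sᵖᵖ-at-2 : ∀ r α → ¬ (2 ∣ r) → Sᵖᵖ r 2 (suc α) ≡ 1 ⊎ 2 ∣ Sᵖᵖ r 2 (suc α)
Sᵖᵖ-at-2 zero          _       r-odd = ⊥-elim (r-odd (2 ∣0))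
Sᵖᵖ-at-2 (suc zero)    zero    _     = inj₁ refl
Sᵖᵖ-at-2 (suc zero)    (suc α) _     = inj₂ (∣m⇒∣m*n 1 (m∣m*n (2 ^ α)))
Sᵖᵖ-at-2 (suc (suc r)) _       _     = inj₂ (2 ∣0)

Sᵖᵖ≡1⊎even : ∀ {r p} α → ¬ (2 ∣ r) → Prime p → Sᵖᵖ r p (suc α) ≡ 1 ⊎ 2 ∣ Sᵖᵖ r p (suc α)
Sᵖᵖ≡1⊎even {r} {p} α r-odd pp with 2 ∣? p
... | yes 2∣p with prime∣prime⇒≡ prime[2] pp 2∣p
...   | refl = Sᵖᵖ-at-2 r α r-odd
Sᵖᵖ≡1⊎even {r} {p} α r-odd pp | no p-odd with Sᵖᵖ r p (suc α) ≟ 0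
... | yes S≡0 = inj₂ (subst (2 ∣_) (sym S≡0) (2 ∣0))
... | no  S≢0 = inj₂ (subst (2 ∣_) (sym (Sᵖᵖ-> (suc α) (Sᵖᵖ≢0⇒> (suc α) S≢0)))
                                     (∣n⇒∣m*n (p ^ α) (odd∸odd-even p-odd r-odd)))

graph-odd⇒≡1 : ∀ {r m v} → ¬ (2 ∣ r) → SchemmelGraph r m v → ¬ (2 ∣ v) → v ≡ 1
graph-odd⇒≡1 _ one _ = refl
graph-odd⇒≡1 {r} r-odd (step {v = v} p (suc α) pp _ _ g) fv-odd with Sᵖᵖ≡1⊎even α r-odd pp
... | inj₁ f≡1 = cong₂ _*_ f≡1 (graph-odd⇒≡1 r-odd g (fv-odd ∘ ∣n⇒∣m*n (Sᵖᵖ r p (suc α))))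
... | inj₂ 2∣f = ⊥-elim (fv-odd (∣m⇒∣m*n v 2∣f))

graph-2*odd⇒prime-power : ∀ {r m v} k → ¬ (2 ∣ r) → ¬ (2 ∣ k) → SchemmelGraph r m v →
  v ≡ 2 * k → ∃₂ λ q e → Prime q × r < q × q ^ e * (q ∸ r) ≡ 2 * k
graph-2*odd⇒prime-power k _ _ one 1≡2k =
  ⊥-elim (prime∤1 prime[2] (subst (2 ∣_) (sym 1≡2k) (m∣m*n k)))
graph-2*odd⇒prime-power {r} k r-odd k-odd (step {v = v} p (suc α) pp _ _ g) fv≡2k
  with Sᵖᵖ≡1⊎even α r-odd pp
... | inj₁ f≡1 = graph-2*odd⇒prime-power k r-odd k-odd g
                   (trans (sym (*-identityˡ v)) (trans (cong (_* v) (sym f≡1)) fv≡2k))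
... | inj₂ 2∣f = p , α , pp , r<p , (begin
      p ^ α * (p ∸ r) ≡⟨ Sᵖᵖ-> (suc α) r<p ⟨
      f               ≡⟨ *-identityʳ f ⟨
      f * 1           ≡⟨ cong (f *_) v≡1 ⟨
      f * v           ≡⟨ fv≡2k ⟩
      2 * k           ∎)
  where
  open ≡-Reasoning
  f : ℕ
  f = Sᵖᵖ r p (suc α)
  v≡1 : v ≡ 1
  v≡1 = graph-odd⇒≡1 r-odd g (cofactor-odd 2∣f fv≡2k k-odd)
  r<p : r < p
  r<p = Sᵖᵖ≢0⇒> (suc α) λ f≡0 → 2*odd≢0 k-odd (trans (sym fv≡2k) (cong (_* v) f≡0))

prime-power-graph : ∀ {r p} k → Prime p → r < p →
                    SchemmelGraph r (p ^ suc k * 1) (p ^ k * (p ∸ r))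
prime-power-graph {r} {p} k pp r<p =
  subst (SchemmelGraph r _) (trans (*-identityʳ _) (Sᵖᵖ-> (suc k) r<p))
        (step p (suc k) pp (s≤s z≤n) (prime∤1 pp) one)

prime∣prodPow⇒≡ : ∀ {s} (p α : Fin s → ℕ) → (∀ i → Prime (p i)) →
  ∀ k (k≤s : k ≤ s) {q} → Prime q → q ∣ prodPow p α k k≤s → ∃ λ i → q ≡ p i × toℕ i < k
prime∣prodPow⇒≡ p α pp zero    _   pq q∣1 = ⊥-elim (prime∤1 pq q∣1)
prime∣prodPow⇒≡ p α pp (suc k) k<s pq q∣ with euclidsLemma _ _ pq q∣
... | inj₁ q∣init with prime∣prodPow⇒≡ p α pp k (≤-trans (n≤1+n k) k<s) pq q∣init
...   | i , q≡pᵢ , i<k = i , q≡pᵢ , m<n⇒m<1+n i<k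
prime∣prodPow⇒≡ p α pp (suc k) k<s pq q∣ | inj₂ q∣pₖ^αₖ =
  fromℕ< k<s , prime∣prime⇒≡ pq (pp _) (prime∣^⇒∣ _ (α (fromℕ< k<s)) pq q∣pₖ^αₖ) ,
  s≤s (≤-reflexive (toℕ-fromℕ< k<s))

prodPow-odd : ∀ {s} (p α : Fin s → ℕ) → (∀ i → Prime (p i)) → (∀ i → 2 < p i) →
              ∀ k (k≤s : k ≤ s) → ¬ (2 ∣ prodPow p α k k≤s)
prodPow-odd p α pp p>2 k k≤s 2∣ with prime∣prodPow⇒≡ p α pp k k≤s prime[2] 2∣
... | i , 2≡pᵢ , _ = <⇒≢ (p>2 i) 2≡pᵢ

prodPow-last : ∀ {t} (p α : Fin (suc t) → ℕ) →
  prodPow p α (suc t) ≤-refl ≡ prodPow p α t (n≤1+n t) * p (fromℕ t) ^ α (fromℕ t)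
prodPow-last {t} p α = cong₂ _*_ (cong (prodPow p α t) (≤-irrelevant _ _))
                                 (cong (λ i → p i ^ α i) (sym (fromℕ-def t)))

module TwiceOddPrimePowerProduct
  {t : ℕ} (p α : Fin (suc t) → ℕ) (pp : ∀ i → Prime (p i)) (p>2 : ∀ i → 2 < p i)
  (increasing : ∀ i j → i <ᶠ j → p i < p j) (α≥1 : ∀ i → 1 ≤ α i)
  {r : ℕ} (r-odd : ¬ (2 ∣ r))
  where

  P Q pₜ αₜ : ℕ
  P  = prodPow p α (suc t) ≤-refl
  Q  = prodPow p α t (n≤1+n t)
  pₜ = p (fromℕ t)
  αₜ = α (fromℕ t)

  P-odd : ¬ (2 ∣ P)
  P-odd = prodPow-odd p α pp p>2 (suc t) ≤-refl

  Q-odd : ¬ (2 ∣ Q)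
  Q-odd = prodPow-odd p α pp p>2 t (n≤1+n t)

  2P≡pₜ^αₜ*2Q : 2 * P ≡ pₜ ^ αₜ * (2 * Q)
  2P≡pₜ^αₜ*2Q = begin
    2 * P              ≡⟨ cong (2 *_) (prodPow-last p α) ⟩
    2 * (Q * pₜ ^ αₜ)  ≡⟨ *-assoc 2 Q (pₜ ^ αₜ) ⟨
    2 * Q * pₜ ^ αₜ    ≡⟨ *-comm (2 * Q) (pₜ ^ αₜ) ⟩
    pₜ ^ αₜ * (2 * Q)  ∎
    where open ≡-Reasoning

  pₜ∣2P : pₜ ∣ 2 * P
  pₜ∣2P = subst (pₜ ∣_) (sym 2P≡pₜ^αₜ*2Q) (∣m⇒∣m*n (2 * Q) (m∣m^n pₜ (α≥1 (fromℕ t))))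

  p≤pₜ : ∀ i → p i ≤ pₜ
  p≤pₜ i with i ≟ᶠ fromℕ t
  ... | yes refl = ≤-refl
  ... | no  i≢t  = <⇒≤ (increasing i (fromℕ t) (≤∧≢⇒<ᶠ (≤fromℕ i) i≢t))

  p<pₜ : ∀ i → toℕ i < t → p i < pₜ
  p<pₜ i i<t = increasing i (fromℕ t) (subst (toℕ i <_) (sym (toℕ-fromℕ t)) i<t)

  prime∣2P⇒≤pₜ : ∀ {q} → Prime q → q ∣ 2 * P → q ≤ pₜ
  prime∣2P⇒≤pₜ pq q∣2P with euclidsLemma 2 P pq q∣2P
  ... | inj₁ q∣2 = ≤-trans (∣⇒≤ q∣2) (<⇒≤ (p>2 (fromℕ t)))
  ... | inj₂ q∣P with prime∣prodPow⇒≡ p α pp (suc t) ≤-refl pq q∣P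
  ...   | i , refl , _ = p≤pₜ i

  pₜ∤2Q : ¬ (pₜ ∣ 2 * Q)
  pₜ∤2Q pₜ∣2Q with euclidsLemma 2 Q (pp (fromℕ t)) pₜ∣2Q
  ... | inj₁ pₜ∣2 = <⇒≱ (p>2 (fromℕ t)) (∣⇒≤ pₜ∣2)
  ... | inj₂ pₜ∣Q with prime∣prodPow⇒≡ p α pp t (n≤1+n t) (pp (fromℕ t)) pₜ∣Q
  ...   | i , pₜ≡pᵢ , i<t = <⇒≢ (p<pₜ i i<t) (sym pₜ≡pᵢ)

  prime-power-value≡2P⇒≡pₜ : ∀ {q} k → Prime q → r < q → q ^ suc k * (q ∸ r) ≡ 2 * P → q ≡ pₜ
  prime-power-value≡2P⇒≡pₜ {q} k pq r<q eq
    with euclidsLemma (q ^ suc k) (q ∸ r) (pp (fromℕ t)) (subst (pₜ ∣_) (sym eq) pₜ∣2P)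
  ... | inj₁ pₜ∣q^[1+k] =
    sym (prime∣prime⇒≡ (pp (fromℕ t)) pq (prime∣^⇒∣ q (suc k) (pp (fromℕ t)) pₜ∣q^[1+k]))
  ... | inj₂ pₜ∣q∸r     = ⊥-elim (<⇒≱ (∣n∸m⇒<n (odd⇒0< r-odd) r<q pₜ∣q∸r) q≤pₜ)
    where
    q≤pₜ : q ≤ pₜ
    q≤pₜ = prime∣2P⇒≤pₜ pq (subst (q ∣_) eq (∣m⇒∣m*n (q ∸ r) (m∣m*n (q ^ k))))

  nontotient⇒conditions : SchemmelNontotient r (2 * P) → Composite (2 * P + r) × pₜ ∸ r ≢ 2 * Q
  nontotient⇒conditions (0<2P , ¬value) =
    ¬prime⇒composite (λ 2P+r-prime → ¬value (_ , 2P+r-graph 2P+r-prime)) ,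
    λ pₜ∸r≡2Q → ¬value (_ , pₜ-graph pₜ∸r≡2Q)
    where
    instance
      2P+r-nonTrivial : NonTrivial (2 * P + r)
      2P+r-nonTrivial = n>1⇒nonTrivial (+-mono-≤ 0<2P (odd⇒0< r-odd))
    2P+r-graph : Prime (2 * P + r) → SchemmelGraph r ((2 * P + r) ^ 1 * 1) (2 * P)
    2P+r-graph 2P+r-prime = subst (SchemmelGraph r _) (trans (*-identityˡ _) (m+n∸n≡m (2 * P) r))
                                  (prime-power-graph 0 2P+r-prime (m<n+m r 0<2P))
    pₜ-graph : pₜ ∸ r ≡ 2 * Q → SchemmelGraph r (pₜ ^ suc αₜ * 1) (2 * P)
    pₜ-graph pₜ∸r≡2Q =
      subst (SchemmelGraph r _) (trans (cong (pₜ ^ αₜ *_) pₜ∸r≡2Q) (sym 2P≡pₜ^αₜ*2Q))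
            (prime-power-graph αₜ (pp (fromℕ t))
              (m∸n≢0⇒n<m (2*odd≢0 Q-odd ∘ trans (sym pₜ∸r≡2Q))))

  conditions⇒nontotient : Composite (2 * P + r) × pₜ ∸ r ≢ 2 * Q → SchemmelNontotient r (2 * P)
  conditions⇒nontotient (composite , pₜ∸r≢2Q) =
    0<2P , λ (_ , g) → no-preimage (graph-2*odd⇒prime-power P r-odd P-odd g refl)
    where
    0<2P : 0 < 2 * P
    0<2P = m≤n⇒m≤o*n 2 (odd⇒0< P-odd)
    no-preimage : ¬ (∃₂ λ q k → Prime q × r < q × q ^ k * (q ∸ r) ≡ 2 * P)
    no-preimage (q , zero , pq , r<q , q∸r≡2P) = composite⇒¬prime composite (subst Prime q≡2P+r pq)
      where
      q≡2P+r : q ≡ 2 * P + r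
      q≡2P+r = trans (sym (m∸n+n≡m (<⇒≤ r<q))) (cong (_+ r) (trans (sym (*-identityˡ _)) q∸r≡2P))
    no-preimage (q , suc k , pq , r<q , eq) with prime-power-value≡2P⇒≡pₜ k pq r<q eq
    ... | refl = pₜ∸r≢2Q (^-*-cancel-∤ pₜ (suc k) αₜ {{prime⇒nonZero pq}}
                            (0<m<n⇒n∤n∸m (odd⇒0< r-odd) r<q) pₜ∤2Q (trans eq 2P≡pₜ^αₜ*2Q))

theorem3p1 : (r : ℕ) → (ro : ℕ) → r ≡ 2 * ro + 1 →
    (t : ℕ) → (p α : Fin (suc t) → ℕ) →
    (∀ i → Prime (p i)) → (∀ i → 2 < p i) →
    (∀ i j → i <ᶠ j → p i < p j) →
    (∀ i → 1 ≤ α i) →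
    SchemmelNontotient r (2 * prodPow p α (suc t) ≤-refl)
      ⇔ (Composite (2 * prodPow p α (suc t) ≤-refl + r)
         × p (fromℕ t) ∸ r ≢ 2 * prodPow p α t (n≤1+n t))
theorem3p1 r ro refl t p α pp p>2 increasing α≥1 = mk⇔ nontotient⇒conditions conditions⇒nontotient
  where open TwiceOddPrimePowerProduct p α pp p>2 increasing α≥1 (2*n+1-odd ro)
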